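{- For $i\in\{1,2\}$ let $G_i$ be a graph and $\mathcal{V}_i$ a family of vertex subsets of $G_i$ of width $k'\le k$, and consider the restricted $k$-dimensional Weisfeiler-Lehman color refinement. (1) If $\mathrm{wl}^k_\infty[\mathcal{V}_1,G_1](v_1,\dots,v_k)=\mathrm{wl}^k_\infty[\mathcal{V}_2,G_2](v'_1,\dots,v'_k)\neq\emptyset$, then for all $j_1,j_2\in\{1,\dots,k\}$, $\mathrm{wl}^k_\infty[\mathcal{V}_1,G_1](v_1,\dots,v_{j_1-1},v_{j_2},v_{j_1+1},\dots,v_k)=\mathrm{wl}^k_\infty[\mathcal{V}_2,G_2](v'_1,\dots,v'_{j_1-1},v'_{j_2},v'_{j_1+1},\dots,v'_k)$. (2) If $\mathrm{wl}^k_\infty[\mathcal{V}_1,G_1](v_1,\dots,v_k)=\mathrm{wl}^k_\infty[\mathcal{V}_2,G_2](v'_1,\dots,v'_k)\neq\emptyset$, then for all indices $j_1,j_2>k'$: if $v_{j_1}$ and $v_{j_2}$ lie in the same connected component of $G_1-\{v_1,\dots,v_{k'}\}$, then $v'_{j_1}$ and $v'_{j_2}$ lie in the same connected component of $G_2-\{v'_1,\dots,v'_{k'}\}$.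
   Context: Width $k'$: the largest set in the family has size $k'$. For a graph $G$ and family $\mathcal{V}$, $\mathcal{V}^+$ is the set of $k$-tuples $(v_1,\dots,v_k)$ with $\{v_1,\dots,v_{k'}\}\in\mathcal{V}$. $\mathrm{wl}^k_i[\mathcal{V},G]$ is $\emptyset$ on tuples outside $\mathcal{V}^+$; on tuples in $\mathcal{V}^+$, $\mathrm{wl}^k_0$ is the isomorphism type of the ordered induced subgraph (equal colors iff $v_i\mapsto v'_i$ is an isomorphism of the induced subgraphs), and $\mathrm{wl}^k_{i+1}(\bar v)=(\mathrm{wl}^k_i(\bar v),\{\!\{(\mathrm{wl}^k_i(x,v_2,\dots,v_k),\dots,\mathrm{wl}^k_i(v_1,\dots,v_{k-1},x)):x\in V(G)\}\!\})$. $\mathrm{wl}^k_\infty$ is $\mathrm{wl}^k_i$ for the least $i$ at which the induced partition stabilizes. Colors are compared across the two graphs (computed jointly). -}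

module Defs where

open import Data.Nat using (ℕ; zero; suc; _≤_; _<_)
open import Data.Fin using (Fin; toℕ; inject≤; _≟_) renaming (zero to fzero; suc to fsuc)
open import Data.Fin.Subset using (Subset; ⁅_⁆; _∪_; ∣_∣) renaming (⊥ to ∅ˢ)
open import Data.Bool using (Bool; true; false)
open import Data.Product using (Σ; _×_; _,_; ∃)
open import Data.Sum using (_⊎_)
open import Relation.Nullary using (¬_; yes; no)
open import Relation.Binary.PropositionalEquality using (_≡_; _≢_)
open import Function.Bundles using (_↔_; Inverse)

record Graph : Set where
  field
    size   : ℕ
    adj    : Fin size → Fin size → Bool
    adj-sym    : ∀ u v → adj u v ≡ adj v u
    adj-irrefl : ∀ v → adj v v ≡ false

record Inst : Set₁ where
  field
    G   : Graph
    fam : Subset (Graph.size G) → Set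
  open Graph G public

Width : ℕ → Inst → Set
Width k' I = (∀ S → Inst.fam I S → ∣ S ∣ ≤ k')
           × (Σ (Subset (Inst.size I)) λ S → Inst.fam I S × ∣ S ∣ ≡ k')

image : ∀ {m n} → (Fin m → Fin n) → Subset n
image {zero}  f = ∅ˢ
image {suc m} f = ⁅ f fzero ⁆ ∪ image (λ i → f (fsuc i))

upd : ∀ {k n} → (Fin k → Fin n) → Fin k → Fin n → (Fin k → Fin n)
upd t j x i with i ≟ j
... | yes _ = x
... | no  _ = t i

data Reach (I : Inst) (S : Fin (Inst.size I) → Set) :
           Fin (Inst.size I) → Fin (Inst.size I) → Set where
  here : ∀ {u} → ¬ S u → Reach I S u u
  step : ∀ {u w x} → ¬ S u → Inst.adj I u w ≡ true → Reach I S w x → Reach I S u x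

module WL (k k' : ℕ) (k'≤k : k' ≤ k) where

  Tuple : Inst → Set
  Tuple I = Fin k → Fin (Inst.size I)

  pre : Fin k' → Fin k
  pre i = inject≤ i k'≤k

  InPlus : (I : Inst) → Tuple I → Set
  InPlus I t = Inst.fam I (image (λ i → t (pre i)))

  IsoType : (I J : Inst) → Tuple I → Tuple J → Set
  IsoType I J t s = ∀ a b → ((t a ≡ t b → s a ≡ s b) × (s a ≡ s b → t a ≡ t b))
                          × Inst.adj I (t a) (t b) ≡ Inst.adj J (s a) (s b)

  -- Same i I J t s :  wl^k_i[𝒱_I,G_I](t) = wl^k_i[𝒱_J,G_J](s)
  -- (colors compared across graphs). The color ∅ is the color of tuples
  -- outside 𝒱⁺; multiset equality is witnessed by a bijection of vertices.
  Same : ℕ → (I J : Inst) → Tuple I → Tuple J → Set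
  Same zero I J t s =
      (¬ InPlus I t × ¬ InPlus J s)
    ⊎ (InPlus I t × InPlus J s × IsoType I J t s)
  Same (suc i) I J t s =
      (¬ InPlus I t × ¬ InPlus J s)
    ⊎ (InPlus I t × InPlus J s × Same i I J t s
       × Σ (Fin (Inst.size I) ↔ Fin (Inst.size J)) λ π →
           ∀ x j → Same i I J (upd t j x) (upd s j (Inverse.to π x)))

  StableOn : ℕ → (I J : Inst) → Set
  StableOn i I J = ∀ t s → (Same i I J t s → Same (suc i) I J t s)
                         × (Same (suc i) I J t s → Same i I J t s)

  Stable : Inst → Inst → ℕ → Set
  Stable I₁ I₂ i = StableOn i I₁ I₁ × StableOn i I₁ I₂
                 × StableOn i I₂ I₁ × StableOn i I₂ I₂

  LeastStable : Inst → Inst → ℕ → Set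
  LeastStable I₁ I₂ i = Stable I₁ I₂ i × (∀ j → j < i → ¬ Stable I₁ I₂ j)

  SameInf : (I₁ I₂ : Inst) → Tuple I₁ → Tuple I₂ → Set
  SameInf I₁ I₂ t s = Σ ℕ λ i → LeastStable I₁ I₂ i × Same i I₁ I₂ t s

  -- wl^k_∞[𝒱,G](t) ≠ ∅  iff  t ∈ 𝒱⁺
  NonEmpty : (I : Inst) → Tuple I → Set
  NonEmpty = InPlus

  InPrefix : (I : Inst) → Tuple I → Fin (Inst.size I) → Set
  InPrefix I t u = Σ (Fin k') λ i → u ≡ t (pre i)

  SameComp : (I : Inst) → Tuple I → Fin (Inst.size I) → Fin (Inst.size I) → Set
  SameComp I t u w = Reach I (InPrefix I t) u w

-- Once the refinement is stable at round i, agreement at round i implies agreement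
-- at round i + 1, so two equally coloured tuples come with a bijection π of the
-- vertices matching the colours of all one-position updates.  Copying v_{j₂} into
-- position j₁ is the update at the vertex v_{j₂}, and the isomorphism type forces π
-- to send v_{j₂} to v'_{j₂}; this gives (1).  For (2), walk along a path of
-- G₁ - {v_1,…,v_{k'}} by repeatedly overwriting the position of the current vertex
-- with its successor; π supplies the matching successor in G₂, adjacency is read off
-- the isomorphism type of the tuple updated at the target position, and the prefix
-- (hence membership in 𝒱⁺ and the deleted set) never changes.
module Submission where

open import Defs
open import Data.Nat using (ℕ; zero; suc; _≤_)
open import Data.Nat.Properties using (<⇒≱)
open import Data.Fin using (Fin; toℕ; _≟_) renaming (zero to fzero; suc to fsuc)
open import Data.Fin.Properties using (toℕ-inject≤; toℕ<n)
open import Data.Fin.Subset using (⁅_⁆; _∪_)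
open import Data.Product using (_×_; _,_; proj₁; proj₂)
open import Data.Sum using (_⊎_; inj₁; inj₂)
open import Data.Bool using (true)
open import Data.Empty using (⊥-elim)
open import Function using (_∘_)
open import Relation.Nullary using (¬_; yes; no)
open import Relation.Binary.PropositionalEquality
open import Function.Bundles using (_↔_; Inverse)

open Inverse using (to; from; strictlyInverseˡ)

image-cong : ∀ {m n} {f g : Fin m → Fin n} → f ≗ g → image f ≡ image g
image-cong {zero}  eq = refl
image-cong {suc m} eq = cong₂ _∪_ (cong ⁅_⁆ (eq fzero)) (image-cong (eq ∘ fsuc))

module _ {k n : ℕ} where

  upd-hit : ∀ (t : Fin k → Fin n) j x → upd t j x j ≡ x
  upd-hit t j x with j ≟ j
  ... | yes _    = refl
  ... | no j≢j = ⊥-elim (j≢j refl)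

  upd-miss : ∀ (t : Fin k → Fin n) {j} x {i} → i ≢ j → upd t j x i ≡ t i
  upd-miss t {j} x {i} i≢j with i ≟ j
  ... | yes i≡j = ⊥-elim (i≢j i≡j)
  ... | no _    = refl

  upd-cong : ∀ {t t′ : Fin k → Fin n} → t ≗ t′ → ∀ j x → upd t j x ≗ upd t′ j x
  upd-cong eq j x i with i ≟ j
  ... | yes _ = refl
  ... | no _  = eq i

  upd-self : ∀ (t : Fin k → Fin n) j → upd t j (t j) ≗ t
  upd-self t j i with i ≟ j
  ... | yes refl = refl
  ... | no _     = refl

module _ {k n m : ℕ} where

  upd-copy : ∀ (t : Fin k → Fin n) (s : Fin k → Fin m) {j₁ j₂ x y}
    → (upd t j₁ x j₁ ≡ upd t j₁ x j₂ → upd s j₁ y j₁ ≡ upd s j₁ y j₂)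
    → j₂ ≢ j₁ → x ≡ t j₂ → y ≡ s j₂
  upd-copy t s {j₁} {j₂} {x} {y} preserves j₂≢j₁ x≡tj₂ = begin
    y                ≡⟨ upd-hit s j₁ y ⟨
    upd s j₁ y j₁    ≡⟨ preserves tj₁≡tj₂ ⟩
    upd s j₁ y j₂    ≡⟨ upd-miss s y j₂≢j₁ ⟩
    s j₂             ∎
    where
      open ≡-Reasoning
      tj₁≡tj₂ : upd t j₁ x j₁ ≡ upd t j₁ x j₂
      tj₁≡tj₂ = trans (upd-hit t j₁ x) (trans x≡tj₂ (sym (upd-miss t x j₂≢j₁)))

Reach-source : ∀ {I S u w} → Reach I S u w → ¬ S u
Reach-source (here u∉)     = u∉
Reach-source (step u∉ _ _) = u∉

module WLProperties (k k' : ℕ) (k'≤k : k' ≤ k) where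
  open WL k k' k'≤k

  pre≢suffix : ∀ p {a : Fin k} → k' ≤ toℕ a → pre p ≢ a
  pre≢suffix p k'≤a refl = <⇒≱ (toℕ<n p) (subst (k' ≤_) (toℕ-inject≤ p k'≤k) k'≤a)

  upd-suffix-prefix : ∀ {n} (t : Fin k → Fin n) {a} x → k' ≤ toℕ a → upd t a x ∘ pre ≗ t ∘ pre
  upd-suffix-prefix t x k'≤a p = upd-miss t x (pre≢suffix p k'≤a)

  InPlus-cong : ∀ I (t t′ : Tuple I) → t ∘ pre ≗ t′ ∘ pre → InPlus I t → InPlus I t′
  InPlus-cong I _ _ eq = subst (Inst.fam I) (image-cong eq)

  module _ {I J : Inst} where

    IsoType-cong : ∀ {t t′ s s′} → t ≗ t′ → s ≗ s′ → IsoType I J t s → IsoType I J t′ s′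
    IsoType-cong et es iso a b
      rewrite sym (et a) | sym (et b) | sym (es a) | sym (es b) = iso a b

    Same-outside : ∀ i {t s} → ¬ InPlus I t → ¬ InPlus J s → Same i I J t s
    Same-outside zero    t∉ s∉ = inj₁ (t∉ , s∉)
    Same-outside (suc i) t∉ s∉ = inj₁ (t∉ , s∉)

    Same-suc⇒Same : ∀ i {t s} → Same (suc i) I J t s → Same i I J t s
    Same-suc⇒Same i (inj₁ (t∉ , s∉))          = Same-outside i t∉ s∉
    Same-suc⇒Same i (inj₂ (_ , _ , same , _)) = same

    Same⇒Same₀ : ∀ i {t s} → Same i I J t s → Same zero I J t s
    Same⇒Same₀ zero    same = same
    Same⇒Same₀ (suc i) same = Same⇒Same₀ i (Same-suc⇒Same i same)

    Same⇒IsoType : ∀ i {t s} → Same i I J t s → InPlus I t ⊎ InPlus J s → IsoType I J t s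
    Same⇒IsoType i same t∈⊎s∈ with Same⇒Same₀ i same | t∈⊎s∈
    ... | inj₁ (t∉ , _) | inj₁ t∈ = ⊥-elim (t∉ t∈)
    ... | inj₁ (_ , s∉) | inj₂ s∈ = ⊥-elim (s∉ s∈)
    ... | inj₂ (_ , _ , iso) | _  = iso

    Same-upd-copy : ∀ i {t s j₁ x y} → Same i I J (upd t j₁ x) (upd s j₁ y)
      → InPlus I (upd t j₁ x) ⊎ InPlus J (upd s j₁ y)
      → ∀ {j₂} → j₂ ≢ j₁ → (x ≡ t j₂ → y ≡ s j₂) × (y ≡ s j₂ → x ≡ t j₂)
    Same-upd-copy i {t} {s} {j₁} same in⁺ {j₂} j₂≢j₁ =
        upd-copy t s (proj₁ (proj₁ (iso j₁ j₂))) j₂≢j₁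
      , upd-copy s t (proj₂ (proj₁ (iso j₁ j₂))) j₂≢j₁
      where iso = Same⇒IsoType i same in⁺

    Outside-cong : ∀ {t t′ s s′} → t ≗ t′ → s ≗ s′
      → ¬ InPlus I t × ¬ InPlus J s → ¬ InPlus I t′ × ¬ InPlus J s′
    Outside-cong {t} {t′} {s} {s′} et es (t∉ , s∉) =
      t∉ ∘ InPlus-cong I t′ t (sym ∘ et ∘ pre) , s∉ ∘ InPlus-cong J s′ s (sym ∘ es ∘ pre)

    Same-cong : ∀ i {t t′ s s′} → t ≗ t′ → s ≗ s′ → Same i I J t s → Same i I J t′ s′
    Same-cong zero et es (inj₁ out) = inj₁ (Outside-cong et es out)
    Same-cong zero {t} {t′} {s} {s′} et es (inj₂ (t∈ , s∈ , iso)) =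
      inj₂ ( InPlus-cong I t t′ (et ∘ pre) t∈ , InPlus-cong J s s′ (es ∘ pre) s∈
           , IsoType-cong et es iso)
    Same-cong (suc i) et es (inj₁ out) = inj₁ (Outside-cong et es out)
    Same-cong (suc i) {t} {t′} {s} {s′} et es (inj₂ (t∈ , s∈ , same , π , matching)) =
      inj₂ ( InPlus-cong I t t′ (et ∘ pre) t∈ , InPlus-cong J s s′ (es ∘ pre) s∈
           , Same-cong i et es same , π
           , λ x j → Same-cong i (upd-cong et j x) (upd-cong es j (to π x)) (matching x j))

    Matching : ℕ → Tuple I → Tuple J → Fin (Inst.size I) ↔ Fin (Inst.size J) → Set
    Matching i t s π = ∀ x j → Same i I J (upd t j x) (upd s j (to π x))

    Matching-copy : ∀ i (t : Tuple I) (s : Tuple J) π → Matching i t s π → ∀ {j₁ j₂} → j₂ ≢ j₁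
      → InPlus I (upd t j₁ (t j₂)) ⊎ InPlus J (upd s j₁ (s j₂)) → to π (t j₂) ≡ s j₂
    Matching-copy i t s π matching {j₁} {j₂} j₂≢j₁ (inj₁ t′∈) =
      proj₁ (Same-upd-copy i (matching (t j₂) j₁) (inj₁ t′∈) j₂≢j₁) refl
    Matching-copy i t s π matching {j₁} {j₂} j₂≢j₁ (inj₂ s′∈) = begin
      to π (t j₂)    ≡⟨ cong (to π) z≡tj₂ ⟨
      to π z         ≡⟨ strictlyInverseˡ π (s j₂) ⟩
      s j₂           ∎
      where
        open ≡-Reasoning
        z = from π (s j₂)
        same : Same i I J (upd t j₁ z) (upd s j₁ (s j₂))
        same = subst (Same i I J (upd t j₁ z) ∘ upd s j₁) (strictlyInverseˡ π (s j₂)) (matching z j₁)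
        z≡tj₂ : z ≡ t j₂
        z≡tj₂ = proj₂ (Same-upd-copy i same (inj₂ s′∈) j₂≢j₁) refl

    Same-suc⇒Same-copy : ∀ i {t s} → Same (suc i) I J t s → InPlus I t
      → ∀ j₁ j₂ → Same i I J (upd t j₁ (t j₂)) (upd s j₁ (s j₂))
    Same-suc⇒Same-copy i (inj₁ (t∉ , _)) t∈ _ _ = ⊥-elim (t∉ t∈)
    Same-suc⇒Same-copy i {t} {s} (inj₂ (_ , _ , same , π , matching)) _ j₁ j₂ with j₂ ≟ j₁
    ... | yes refl = Same-cong i (sym ∘ upd-self t j₁) (sym ∘ upd-self s j₁) same
    ... | no j₂≢j₁ with Same⇒Same₀ i (matching (t j₂) j₁)
    ...   | inj₂ (t′∈ , _) =
            subst (Same i I J (upd t j₁ (t j₂)) ∘ upd s j₁)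
                  (Matching-copy i t s π matching j₂≢j₁ (inj₁ t′∈)) (matching (t j₂) j₁)
    ...   | inj₁ (t′∉ , s″∉) = Same-outside i t′∉ s′∉
            where
              s′∉ : ¬ InPlus J (upd s j₁ (s j₂))
              s′∉ s′∈ = s″∉ (subst (InPlus J ∘ upd s j₁)
                                   (sym (Matching-copy i t s π matching j₂≢j₁ (inj₂ s′∈))) s′∈)

  module Walks (i : ℕ) (I₁ I₂ : Inst)
               (Same-suc : ∀ t s → Same i I₁ I₂ t s → Same (suc i) I₁ I₂ t s)
               (t₀ : Tuple I₁) (s₀ : Tuple I₂) (t₀∈ : InPlus I₁ t₀) where

    avoid-transfer : ∀ {t s} → IsoType I₁ I₂ t s → t ∘ pre ≗ t₀ ∘ pre → s ∘ pre ≗ s₀ ∘ pre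
      → ∀ {a} → ¬ InPrefix I₁ t₀ (t a) → ¬ InPrefix I₂ s₀ (s a)
    avoid-transfer iso et es {a} ta∉ (p , sa≡s₀p) =
      ta∉ (p , trans (proj₂ (proj₁ (iso a (pre p))) (trans sa≡s₀p (sym (es p)))) (et p))

    walk-transfer : ∀ {u w} → Reach I₁ (InPrefix I₁ t₀) u w
      → ∀ {t s} → t ∘ pre ≗ t₀ ∘ pre → s ∘ pre ≗ s₀ ∘ pre → Same i I₁ I₂ t s
      → ∀ {a b} → a ≢ b → k' ≤ toℕ a → k' ≤ toℕ b → t a ≡ u → t b ≡ w
      → Reach I₂ (InPrefix I₂ s₀) (s a) (s b)
    walk-transfer (here u∉) {t} {s} et es same {a} {b} _ _ _ refl tb≡ta =
      subst (Reach I₂ _ (s a)) (proj₁ (proj₁ (iso a b)) (sym tb≡ta))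
            (here (avoid-transfer iso et es u∉))
      where iso = Same⇒IsoType i same (inj₁ (InPlus-cong I₁ t₀ t (sym ∘ et) t₀∈))
    walk-transfer (step {w = v} u∉ uv v⇝w) {t} {s} et es same {a} {b} a≢b a-suf b-suf refl tb≡w
      with Same-suc t s same
    ... | inj₁ (t∉ , _) = ⊥-elim (t∉ (InPlus-cong I₁ t₀ t (sym ∘ et) t₀∈))
    ... | inj₂ (t∈ , _ , _ , π , matching) =
      step (avoid-transfer (Same⇒IsoType i same (inj₁ t∈)) et es u∉) sa~y y⇝sb
      where
        y = to π v
        b≢a : b ≢ a
        b≢a = a≢b ∘ sym
        y⇝sb : Reach I₂ (InPrefix I₂ s₀) y (s b)
        y⇝sb = subst₂ (Reach I₂ _) (upd-hit s a y) (upd-miss s y b≢a)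
          (walk-transfer v⇝w
            (λ p → trans (upd-suffix-prefix t v a-suf p) (et p))
            (λ p → trans (upd-suffix-prefix s y a-suf p) (es p))
            (matching v a) a≢b a-suf b-suf (upd-hit t a v) (trans (upd-miss t v b≢a) tb≡w))
        iso : IsoType I₁ I₂ (upd t b v) (upd s b y)
        iso = Same⇒IsoType i (matching v b)
                (inj₁ (InPlus-cong I₁ t (upd t b v) (sym ∘ upd-suffix-prefix t v b-suf) t∈))
        sa~y : Inst.adj I₂ (s a) y ≡ true
        sa~y = begin
          Inst.adj I₂ (s a) y
            ≡⟨ cong₂ (Inst.adj I₂) (upd-miss s y a≢b) (upd-hit s b y) ⟨
          Inst.adj I₂ (upd s b y a) (upd s b y b)
            ≡⟨ proj₂ (iso a b) ⟨
          Inst.adj I₁ (upd t b v a) (upd t b v b)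
            ≡⟨ cong₂ (Inst.adj I₁) (upd-miss t v a≢b) (upd-hit t b v) ⟩
          Inst.adj I₁ (t a) v
            ≡⟨ uv ⟩
          true
            ∎
          where open ≡-Reasoning

lemma1 : (k k' : ℕ) (k'≤k : k' ≤ k) (I₁ I₂ : Inst)
    → Width k' I₁ → Width k' I₂
    → let open WL k k' k'≤k in
    (t : Tuple I₁) (s : Tuple I₂)
    → SameInf I₁ I₂ t s → NonEmpty I₁ t
    → (∀ j₁ j₂ → SameInf I₁ I₂ (upd t j₁ (t j₂)) (upd s j₁ (s j₂)))
    × (∀ j₁ j₂ → k' ≤ toℕ j₁ → k' ≤ toℕ j₂
    → SameComp I₁ t (t j₁) (t j₂) → SameComp I₂ s (s j₁) (s j₂))
lemma1 k k' k'≤k I₁ I₂ _ _ t s (i , least , same) t∈ =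
  (λ j₁ j₂ → i , least , Same-suc⇒Same-copy i (Same-suc t s same) t∈ j₁ j₂) , components
  where
    open WL k k' k'≤k
    open WLProperties k k' k'≤k

    Same-suc : ∀ t s → Same i I₁ I₂ t s → Same (suc i) I₁ I₂ t s
    Same-suc t s = proj₁ (proj₁ (proj₂ (proj₁ least)) t s)

    open Walks i I₁ I₂ Same-suc t s t∈

    components : ∀ j₁ j₂ → k' ≤ toℕ j₁ → k' ≤ toℕ j₂
      → SameComp I₁ t (t j₁) (t j₂) → SameComp I₂ s (s j₁) (s j₂)
    components j₁ j₂ j₁-suf j₂-suf walk with j₁ ≟ j₂
    ... | yes refl = here (avoid-transfer (Same⇒IsoType i same (inj₁ t∈))
                                          (λ _ → refl) (λ _ → refl) (Reach-source walk))
    ... | no j₁≢j₂ = walk-transfer walk (λ _ → refl) (λ _ → refl) same j₁≢j₂ j₁-suf j₂-suf refl refl
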